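{- Let $f: A^*\to B^*$ be a non-erasing morphism that is strongly quasiperiodic on finite words. Then for every non-empty finite word $u$ over $A$ and every letter $\alpha\in A$, the quasiperiod of $f(u)$ is a factor of $f(\alpha)^3$ of length less than $2|f(\alpha)|$.
   Context: For a non-empty word $q$, a finite word $w$ is $q$-quasiperiodic if $w \neq q$ and every position of $w$ lies within some occurrence of $q$ in $w$. A word is quasiperiodic if it is $q$-quasiperiodic for some $q$; the quasiperiod of a quasiperiodic word is its shortest such $q$. The morphism $f$ is strongly quasiperiodic on finite words if $f(u)$ is quasiperiodic for every non-empty finite word $u$ over $A$. -}

module Defs where

open import Data.Nat using (ℕ; _≤_; _<_; _+_; _*_)
open import Data.Fin using (Fin)
open import Data.List using (List; []; _++_; length; concatMap)
open import Data.Product using (Σ; ∃; _×_; _,_)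
open import Relation.Binary.PropositionalEquality using (_≡_; _≢_)

OccursAt : {B : Set} → List B → List B → ℕ → Set
OccursAt {B} q w i = Σ (List B) λ x → Σ (List B) λ y → (w ≡ x ++ q ++ y) × (length x ≡ i)

QPeriodic : {B : Set} → List B → List B → Set
QPeriodic q w =
  (q ≢ []) × (w ≢ q) ×
  (∀ j → j < length w → ∃ λ i → OccursAt q w i × i ≤ j × j < i + length q)

Quasiperiodic : {B : Set} → List B → Set
Quasiperiodic {B} w = ∃ λ (q : List B) → QPeriodic q w

IsQuasiperiod : {B : Set} → List B → List B → Set
IsQuasiperiod q w = QPeriodic q w × (∀ q′ → QPeriodic q′ w → length q ≤ length q′)

-- A morphism A* → B* is determined by the images of letters.
extend : {A B : Set} → (A → List B) → List A → List B
extend h = concatMap h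

NonErasing : {A B : Set} → (A → List B) → Set
NonErasing h = ∀ a → h a ≢ []

StronglyQuasiperiodic : {A B : Set} → (A → List B) → Set
StronglyQuasiperiodic h = ∀ u → u ≢ [] → Quasiperiodic (extend h u)

Factor : {B : Set} → List B → List B → Set
Factor {B} q v = Σ (List B) λ x → Σ (List B) λ y → v ≡ x ++ q ++ y

cube : {B : Set} → List B → List B
cube v = v ++ v ++ v

-- Pump the image of u: every cover c of W = f(u) f(α)^k f(u), k large, can be
-- shortened (two overlapping occurrences less than |c|/2 apart yield a shorter
-- border that still covers) until an occurrence of c starts inside the block
-- f(α)^k.  As c is a cover of W it is at least as long as the quasiperiod q of
-- f(u) and begins with q, so q occurs inside f(α)^k.  Two occurrences of q a
-- period |f(α)| apart would, by the same shortening, give a cover of f(u) shorter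
-- than q; hence |q| < 2|f(α)|, and an occurrence of such a short word in a power
-- of f(α) is already an occurrence in f(α)^3.
module Submission where

open import Defs
open import Data.Nat using (ℕ; zero; suc; pred; _+_; _*_; _∸_; _≤_; _<_; z≤n; s≤s; _≤?_)
open import Data.Nat.Properties
open import Data.Nat.Induction using (<-wellFounded)
open import Data.Nat.Tactic.RingSolver using (solve-∀)
open import Data.List using (List; []; _∷_; _++_; length; replicate)
open import Data.List.Properties using (++-assoc; ++-identityʳ; length-++; ∷-injective; concatMap-++; ++-conicalˡ)
open import Data.Product using (∃; _×_; _,_; proj₁; proj₂)
open import Data.Sum using (_⊎_; inj₁; inj₂)
open import Data.Empty using (⊥; ⊥-elim)
open import Data.Fin using (Fin)
open import Induction.WellFounded using (Acc; acc)
open import Relation.Nullary using (yes; no)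
open import Relation.Binary.PropositionalEquality
open import Function using (_∘_)

Covers : {B : Set} → List B → List B → Set
Covers q w = ∀ j → j < length w → ∃ λ i → OccursAt q w i × i ≤ j × j < i + length q

module _ {B : Set} where

  ++-split : (xs ys us vs : List B) → xs ++ ys ≡ us ++ vs → length xs ≤ length us →
             ∃ λ m → us ≡ xs ++ m × ys ≡ m ++ vs
  ++-split []       ys us       vs eq _ = us , refl , eq
  ++-split (x ∷ xs) ys (u ∷ us) vs eq (s≤s le) with ∷-injective eq
  ... | refl , eq′ with ++-split xs ys us vs eq′ le
  ... | m , us≡ , ys≡ = m , cong (x ∷_) us≡ , ys≡

  length-++-++ : (x q y : List B) → length (x ++ q ++ y) ≡ length x + length q + length y
  length-++-++ x q y = begin
    length (x ++ q ++ y)               ≡⟨ length-++ x ⟩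
    length x + length (q ++ y)         ≡⟨ cong (length x +_) (length-++ q) ⟩
    length x + (length q + length y)   ≡⟨ +-assoc (length x) _ _ ⟨
    length x + length q + length y     ∎
    where open ≡-Reasoning

  ++-proper-prefix-length : {w c b : List B} → w ≡ c ++ b → w ≢ c → length c < length w
  ++-proper-prefix-length {c = c} {b = []} w≡ w≢c = ⊥-elim (w≢c (trans w≡ (++-identityʳ c)))
  ++-proper-prefix-length {c = c} {b = _ ∷ b} refl _ = begin-strict
    length c                 <⟨ m<m+n (length c) (s≤s z≤n) ⟩
    length c + suc (length b) ≡⟨ length-++ c ⟨
    length (c ++ _ ∷ b)      ∎
    where open ≤-Reasoning

  ≢[]⇒0<length : {xs : List B} → xs ≢ [] → 0 < length xs
  ≢[]⇒0<length {[]}    xs≢[] = ⊥-elim (xs≢[] refl)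
  ≢[]⇒0<length {_ ∷ _} _     = s≤s z≤n

  0<length⇒≢[] : {xs : List B} → 0 < length xs → xs ≢ []
  0<length⇒≢[] 0<xs refl = <-irrefl refl 0<xs

  length<⇒≢ : {xs ys : List B} → length xs < length ys → ys ≢ xs
  length<⇒≢ xs<ys refl = <-irrefl refl xs<ys

  OccursAt⇒Factor : {q w : List B} {i : ℕ} → OccursAt q w i → Factor q w
  OccursAt⇒Factor (x , y , w≡ , _) = x , y , w≡

  OccursAt-end≤length : {q w : List B} {i : ℕ} → OccursAt q w i → i + length q ≤ length w
  OccursAt-end≤length {q} (x , y , refl , refl) = begin
    length x + length q                ≤⟨ m≤m+n _ (length y) ⟩
    length x + length q + length y     ≡⟨ length-++-++ x q y ⟨
    length (x ++ q ++ y)               ∎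
    where open ≤-Reasoning

  OccursAt-++⁺ˡ : {q C : List B} (A : List B) {i : ℕ} → OccursAt q C i → OccursAt q (A ++ C) (length A + i)
  OccursAt-++⁺ˡ A (x , y , refl , refl) = A ++ x , y , sym (++-assoc A x _) , length-++ A

  OccursAt-++⁺ʳ : {q A : List B} (C : List B) {i : ℕ} → OccursAt q A i → OccursAt q (A ++ C) i
  OccursAt-++⁺ʳ {q} C (x , y , refl , refl) =
    x , y ++ C , trans (++-assoc x _ C) (cong (x ++_) (++-assoc q y C)) , refl

  OccursAt-++⁻ˡ : {q A C : List B} {i : ℕ} → OccursAt q (A ++ C) i → i + length q ≤ length A → OccursAt q A i
  OccursAt-++⁻ˡ {q} {A} {C} (x , y , A++C≡ , refl) end≤A
    with ++-split (x ++ q) y A C (trans (++-assoc x q y) (sym A++C≡)) (≤-trans (≤-reflexive (length-++ x)) end≤A)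
  ... | m , A≡ , _ = x , m , trans A≡ (++-assoc x q m) , refl

  OccursAt-++⁻ʳ : {q A C : List B} {i : ℕ} → OccursAt q (A ++ C) i → length A ≤ i → OccursAt q C (i ∸ length A)
  OccursAt-++⁻ʳ {q} {A} (x , y , A++C≡ , refl) A≤x with ++-split A _ x (q ++ y) A++C≡ A≤x
  ... | m , refl , C≡ = m , y , C≡ , sym (trans (cong (_∸ length A) (length-++ A)) (m+n∸m≡n (length A) (length m)))

  OccursAt-prefix : {q m W : List B} {i : ℕ} → OccursAt (q ++ m) W i → OccursAt q W i
  OccursAt-prefix {q} {m} (x , y , W≡ , x≡i) = x , m ++ y , trans W≡ (cong (x ++_) (++-assoc q m y)) , x≡i

  OccursAt-trans : {c d W : List B} {i i′ : ℕ} → OccursAt c W i → OccursAt d c i′ → OccursAt d W (i + i′)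
  OccursAt-trans {d = d} (x , y , refl , refl) (x′ , y′ , refl , refl) =
    x ++ x′ , y′ ++ y ,
    trans (cong (x ++_) (trans (++-assoc x′ _ y) (cong (x′ ++_) (++-assoc d y′ y)))) (sym (++-assoc x x′ _)) ,
    length-++ x

  Covers-trans : {c d W : List B} → Covers c W → Covers d c → Covers d W
  Covers-trans {c} {d} c-covers-W d-covers-c j j<W with c-covers-W j j<W
  ... | i , c-at-i , i≤j , j<i+c with d-covers-c (j ∸ i) (+-cancelˡ-< i _ _ (subst (_< i + length c) (sym j≡) j<i+c))
    where j≡ = m+[n∸m]≡n i≤j
  ... | i′ , d-at-i′ , i′≤ , <i′+d = i + i′ , OccursAt-trans c-at-i d-at-i′ ,
        ≤-trans (+-monoʳ-≤ i i′≤) (≤-reflexive (m+[n∸m]≡n i≤j)) ,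
        (begin-strict
          j                    ≡⟨ m+[n∸m]≡n i≤j ⟨
          i + (j ∸ i)          <⟨ +-monoʳ-< i <i′+d ⟩
          i + (i′ + length d)  ≡⟨ +-assoc i i′ _ ⟨
          i + i′ + length d    ∎)
    where open ≤-Reasoning

  Covers-nonempty : {c W : List B} → Covers c W → 0 < length W → 0 < length c
  Covers-nonempty c-covers-W 0<W with c-covers-W 0 0<W
  ... | .0 , _ , z≤n , 0<c = 0<c

  Covers⇒OccursAt-start : {c W : List B} → Covers c W → 0 < length W → OccursAt c W 0
  Covers⇒OccursAt-start c-covers-W 0<W with c-covers-W 0 0<W
  ... | .0 , c-at-0 , z≤n , _ = c-at-0

  Covers⇒prefix : {c W : List B} → Covers c W → 0 < length W → ∃ λ b → W ≡ c ++ b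
  Covers⇒prefix c-covers-W 0<W with Covers⇒OccursAt-start c-covers-W 0<W
  ... | [] , b , W≡ , refl = b , W≡

  Covers⇒suffix : {c W : List B} → Covers c W → 0 < length W → ∃ λ a → W ≡ a ++ c
  Covers⇒suffix {c} {W} c-covers-W 0<W with c-covers-W (pred (length W)) (pred<n 0<W)
    where
    pred<n : {n : ℕ} → 0 < n → pred n < n
    pred<n (s≤s _) = ≤-refl
  ... | _ , (x , [] , W≡ , _) , _ = x , trans W≡ (cong (x ++_) (++-identityʳ c))
  ... | _ , (x , _ ∷ y , W≡ , refl) , _ , last<x+c = ⊥-elim (<⇒≱ last<x+c (begin
        length x + length c                    ≤⟨ m≤m+n _ (length y) ⟩
        length x + length c + length y         ≡⟨ cong pred (sym (trans (length-++-++ x c _) (+-suc _ (length y)))) ⟩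
        pred (length (x ++ c ++ _ ∷ y))        ≡⟨ cong (pred ∘ length) W≡ ⟨
        pred (length W)                        ∎))
    where open ≤-Reasoning

  border-Covers : {c m d e : List B} → c ≡ m ++ d → c ≡ d ++ e → length m ≤ length d → Covers d c
  border-Covers {c} {m} {d} {e} c≡md c≡de m≤d j j<c with suc j ≤? length d
  ... | yes j<d = 0 , ([] , e , c≡de , refl) , z≤n , j<d
  ... | no j≮d = length m , (m , [] , trans c≡md (cong (m ++_) (sym (++-identityʳ d))) , refl) ,
        ≤-trans m≤d (≮⇒≥ j≮d) , subst (j <_) (trans (cong length c≡md) (length-++ m)) j<c

  -- Covering the prefix x of the text needs no occurrence reaching past x:
  -- positions from |z| on are covered by the occurrence of c that ends x.
  Covers-prefix : {c x y z : List B} → Covers c (x ++ y) → x ≡ z ++ c → Covers c x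
  Covers-prefix {c} {x} {y} {z} c-covers-xy x≡zc j j<x with length z ≤? j
  ... | yes z≤j = length z , (z , [] , trans x≡zc (cong (z ++_) (sym (++-identityʳ c))) , refl) , z≤j ,
        subst (j <_) x≡z+c j<x
    where x≡z+c = trans (cong length x≡zc) (length-++ z)
  ... | no z≰j with c-covers-xy j (<-≤-trans j<x (≤-trans (m≤m+n _ (length y)) (≤-reflexive (sym (length-++ x)))))
  ... | i , c-at-i , i≤j , j<i+c = i , OccursAt-++⁻ˡ c-at-i end≤x , i≤j , j<i+c
    where
    end≤x : i + length c ≤ length x
    end≤x = ≤-trans (+-monoˡ-≤ (length c) (≤-trans i≤j (<⇒≤ (≰⇒> z≰j))))
                    (≤-reflexive (sym (trans (cong length x≡zc) (length-++ z))))

  -- The suffix of c after m is then also a prefix of c, and a border that long covers c.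
  shift⇒border-Covers : (c y m y′ : List B) {s : ℕ} → c ++ y ≡ m ++ c ++ y′ → length m ≡ s → s + s ≤ length c →
                        ∃ λ d → Covers d c × s + length d ≡ length c
  shift⇒border-Covers c y m y′ shifted refl 2m≤c
    with ++-split m (c ++ y′) c y (sym shifted) (≤-trans (m≤m+n _ _) 2m≤c)
  ... | d , c≡md , cy′≡dy = d , border-Covers c≡md (proj₁ (proj₂ prefix)) m≤d , sym c≡m+d
    where
    c≡m+d : length c ≡ length m + length d
    c≡m+d = trans (cong length c≡md) (length-++ m)
    prefix : ∃ λ e → c ≡ d ++ e × y ≡ e ++ y′
    prefix = ++-split d y c y′ (sym cy′≡dy) (≤-trans (m≤n+m _ (length m)) (≤-reflexive (sym c≡m+d)))
    m≤d : length m ≤ length d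
    m≤d = +-cancelˡ-≤ (length m) _ _ (≤-trans 2m≤c (≤-reflexive c≡m+d))

  overlap⇒border-Covers : {c X : List B} {i s : ℕ} → OccursAt c X i → OccursAt c X (i + s) → s + s ≤ length c →
                          ∃ λ d → Covers d c × s + length d ≡ length c
  overlap⇒border-Covers {c} {s = s} (x , y , X≡ , refl) (x′ , y′ , X≡′ , x′≡)
    with ++-split x (c ++ y) x′ (c ++ y′) (trans (sym X≡) X≡′) (≤-trans (m≤m+n _ s) (≤-reflexive (sym x′≡)))
  ... | m , refl , shifted = shift⇒border-Covers c y m y′ shifted m≡s
    where
    m≡s : length m ≡ s
    m≡s = +-cancelˡ-≡ (length x) _ _ (trans (sym (length-++ x)) x′≡)

  overlap⇒shorter-Covers : {c X Y : List B} {i s : ℕ} → Covers c X → OccursAt c Y i → OccursAt c Y (i + s) →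
                           0 < s → s + s ≤ length c → ∃ λ d → Covers d X × length d < length c
  overlap⇒shorter-Covers c-covers-X c-at-i c-at-i+s 0<s 2s≤c with overlap⇒border-Covers c-at-i c-at-i+s 2s≤c
  ... | d , d-covers-c , s+d≡c = d , Covers-trans c-covers-X d-covers-c , subst (_ <_) s+d≡c (m<n+m _ 0<s)

  descend-on-length : (P : List B → Set) {R : Set} → (∀ {c} → P c → (∃ λ d → P d × length d < length c) ⊎ R) →
                      ∀ {c} → P c → R
  descend-on-length P {R} step = go (<-wellFounded _)
    where
    go : ∀ {c} → Acc _<_ (length c) → P c → R
    go (acc rs) pc with step pc
    ... | inj₂ r              = r
    ... | inj₁ (d , pd , d<c) = go (rs d<c) pd

  pow : List B → ℕ → List B
  pow v zero    = []
  pow v (suc k) = v ++ pow v k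

  pow-+ : (v : List B) (a b : ℕ) → pow v (a + b) ≡ pow v a ++ pow v b
  pow-+ v zero    b = refl
  pow-+ v (suc a) b = trans (cong (v ++_) (pow-+ v a b)) (sym (++-assoc v _ _))

  pow-comm : (v : List B) (a b : ℕ) → pow v a ++ pow v b ≡ pow v b ++ pow v a
  pow-comm v a b = trans (sym (pow-+ v a b)) (trans (cong (pow v) (+-comm a b)) (pow-+ v b a))

  pow-sucʳ : (v : List B) (k : ℕ) → pow v (suc k) ≡ pow v k ++ v
  pow-sucʳ v zero    = ++-identityʳ v
  pow-sucʳ v (suc k) = trans (cong (v ++_) (pow-sucʳ v k)) (sym (++-assoc v _ v))

  length-pow : (v : List B) (k : ℕ) → length (pow v k) ≡ k * length v
  length-pow v zero    = refl
  length-pow v (suc k) = trans (length-++ v) (cong (length v +_) (length-pow v k))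

  k≤length-pow : {v : List B} → 0 < length v → (k : ℕ) → k ≤ length (pow v k)
  k≤length-pow {v} 0<v k = begin
    k                 ≡⟨ *-identityʳ k ⟨
    k * 1             ≤⟨ *-monoʳ-≤ k 0<v ⟩
    k * length v      ≡⟨ length-pow v k ⟨
    length (pow v k)  ∎
    where open ≤-Reasoning

  pow-3 : (v : List B) → pow v 3 ≡ cube v
  pow-3 v = cong (λ z → v ++ v ++ z) (++-identityʳ v)

  -- An occurrence in v^k can be moved |v| to the left until it starts in the
  -- first copy of v; a word that short then ends within the first three copies.
  pow-occurrence⇒Factor-cube : {q v : List B} → 0 < length v → (k : ℕ) {t : ℕ} → OccursAt q (pow v k) t →
                               length q ≤ suc (2 * length v) → Factor q (cube v)
  pow-occurrence⇒Factor-cube {v = v} 0<v k {t} q-at-t short with length v ≤? t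
  pow-occurrence⇒Factor-cube 0<v zero    q-at-t _     | yes v≤t =
    ⊥-elim (<⇒≱ (<-≤-trans 0<v v≤t) (≤-trans (m≤m+n _ _) (OccursAt-end≤length q-at-t)))
  pow-occurrence⇒Factor-cube 0<v (suc k) q-at-t short | yes v≤t =
    pow-occurrence⇒Factor-cube 0<v k (OccursAt-++⁻ʳ q-at-t v≤t) short
  pow-occurrence⇒Factor-cube {q} {v} 0<v k {t} q-at-t short | no v≰t =
    subst (Factor q) (pow-3 v) (OccursAt⇒Factor (OccursAt-++⁻ˡ q-in-v³++vᵏ end≤3v))
    where
    p = length v
    q-in-v³++vᵏ : OccursAt q (pow v 3 ++ pow v k) t
    q-in-v³++vᵏ = subst (λ X → OccursAt q X t) (pow-comm v k 3) (OccursAt-++⁺ʳ (pow v 3) q-at-t)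
    end≤3v : t + length q ≤ length (pow v 3)
    end≤3v = begin
      t + length q            ≤⟨ +-monoʳ-≤ t short ⟩
      t + suc (2 * p)         ≡⟨ +-suc t _ ⟩
      suc t + 2 * p           ≤⟨ +-monoˡ-≤ (2 * p) (≰⇒> v≰t) ⟩
      3 * p                   ≡⟨ length-pow v 3 ⟨
      length (pow v 3)        ∎
      where open ≤-Reasoning

  extend-replicate : {A : Set} (f : A → List B) (a : A) (k : ℕ) → extend f (replicate k a) ≡ pow (f a) k
  extend-replicate f a zero    = refl
  extend-replicate f a (suc k) = cong (f a ++_) (extend-replicate f a k)

  extend-pumped : {A : Set} (f : A → List B) (x : List A) (a : A) (k : ℕ) (y : List A) →
                  extend f (x ++ replicate k a ++ y) ≡ extend f x ++ pow (f a) k ++ extend f y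
  extend-pumped f x a k y = begin
    extend f (x ++ replicate k a ++ y)
      ≡⟨ concatMap-++ f x _ ⟩
    extend f x ++ extend f (replicate k a ++ y)
      ≡⟨ cong (extend f x ++_) (concatMap-++ f (replicate k a) y) ⟩
    extend f x ++ extend f (replicate k a) ++ extend f y
      ≡⟨ cong (λ z → extend f x ++ z ++ extend f y) (extend-replicate f a k) ⟩
    extend f x ++ pow (f a) k ++ extend f y
      ∎
    where open ≡-Reasoning

  extend-nonempty : {A : Set} {f : A → List B} → NonErasing f → {u : List A} → u ≢ [] → 0 < length (extend f u)
  extend-nonempty             _  {[]}    u≢[] = ⊥-elim (u≢[] refl)
  extend-nonempty {f = f} f-ne {a ∷ u} _    =
    <-≤-trans (≢[]⇒0<length (f-ne a)) (≤-trans (m≤m+n _ _) (≤-reflexive (sym (length-++ (f a)))))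

module Pumping {B : Set} (w v q : List B) (q-quasiperiod : IsQuasiperiod q w) (0<w : 0 < length w) (0<v : 0 < length v)
               (k : ℕ) (4w≤vᵏ : 4 * length w ≤ length (pow v k)) where

  ℓ p K : ℕ
  ℓ = length w
  p = length v
  K = length (pow v k)

  V W : List B
  V = pow v k
  W = w ++ V ++ w

  length-W : length W ≡ ℓ + (K + ℓ)
  length-W = trans (length-++ w) (cong (ℓ +_) (length-++ V))

  q-covers-w : Covers q w
  q-covers-w = proj₂ (proj₂ (proj₁ q-quasiperiod))

  q<w : length q < ℓ
  q<w = ++-proper-prefix-length (proj₂ (Covers⇒prefix q-covers-w 0<w)) (proj₁ (proj₂ (proj₁ q-quasiperiod)))

  no-shorter-cover : {d : List B} → Covers d w → length d < length q → ⊥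
  no-shorter-cover {d} d-covers-w d<q = <⇒≱ d<q (proj₂ q-quasiperiod d (d≢[] , length<⇒≢ d<w , d-covers-w))
    where
    d≢[] : d ≢ []
    d≢[] = 0<length⇒≢[] (Covers-nonempty d-covers-w 0<w)
    d<w : length d < ℓ
    d<w = <-trans d<q q<w

  q-prefix-of-W : ∃ λ b → W ≡ q ++ b
  q-prefix-of-W with Covers⇒prefix q-covers-w 0<w
  ... | b , w≡qb = b ++ V ++ w , trans (cong (_++ V ++ w) w≡qb) (++-assoc q b _)

  short-suffix-starts-after-V : {a c : ℕ} → a + c ≡ ℓ + (K + ℓ) → c ≤ ℓ → ℓ + K ≤ a
  short-suffix-starts-after-V {a} {c} a+c≡W c≤ℓ = +-cancelʳ-≤ c (ℓ + K) a (begin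
    ℓ + K + c      ≤⟨ +-monoʳ-≤ (ℓ + K) c≤ℓ ⟩
    ℓ + K + ℓ      ≡⟨ +-assoc ℓ K ℓ ⟩
    ℓ + (K + ℓ)    ≡⟨ a+c≡W ⟨
    a + c          ∎)
    where open ≤-Reasoning

  long-suffix-overlaps-prefix : {a c : ℕ} → a + c ≡ ℓ + (K + ℓ) → K < c → a + a ≤ c
  long-suffix-overlaps-prefix {a} {c} a+c≡W K<c = <⇒≤ (begin-strict
    a + a              <⟨ +-mono-< a<2ℓ a<2ℓ ⟩
    ℓ + ℓ + (ℓ + ℓ)    ≡⟨ lemma ℓ ⟩
    4 * ℓ              ≤⟨ 4w≤vᵏ ⟩
    K                  <⟨ K<c ⟩
    c                  ∎)
    where
    open ≤-Reasoning
    lemma : ∀ n → n + n + (n + n) ≡ 4 * n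
    lemma = solve-∀
    a<2ℓ : a < ℓ + ℓ
    a<2ℓ = +-cancelʳ-< K a (ℓ + ℓ) (begin-strict
      a + K          <⟨ +-monoʳ-< a K<c ⟩
      a + c          ≡⟨ a+c≡W ⟩
      ℓ + (K + ℓ)    ≡⟨ cong (ℓ +_) (+-comm K ℓ) ⟩
      ℓ + (ℓ + K)    ≡⟨ +-assoc ℓ ℓ K ⟨
      ℓ + ℓ + K      ∎)

  early-start-overlaps-prefix : {s c : ℕ} → s < ℓ → K < s + c → s + s ≤ c
  early-start-overlaps-prefix {s} {c} s<ℓ K<s+c = ≮⇒≥ λ c<2s → <-irrefl refl (begin-strict
    K                          <⟨ K<s+c ⟩
    s + c                      <⟨ +-monoʳ-< s c<2s ⟩
    s + (s + s)                <⟨ +-mono-< s<ℓ (+-mono-< s<ℓ s<ℓ) ⟩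
    ℓ + (ℓ + ℓ)                ≤⟨ +-monoʳ-≤ ℓ (+-monoʳ-≤ ℓ (m≤m+n ℓ (ℓ + 0))) ⟩
    4 * ℓ                      ≤⟨ 4w≤vᵏ ⟩
    K                          ∎)
    where open ≤-Reasoning

  0<W : 0 < length W
  0<W = <-≤-trans 0<w (≤-trans (m≤m+n ℓ _) (≤-reflexive (sym (length-++ w))))

  K<W : K < length W
  K<W = begin-strict
    K              <⟨ m<n+m K 0<w ⟩
    ℓ + K          ≤⟨ +-monoʳ-≤ ℓ (m≤m+n K ℓ) ⟩
    ℓ + (K + ℓ)    ≡⟨ length-W ⟨
    length W       ∎
    where open ≤-Reasoning

  suffix-length : (a c : List B) → W ≡ a ++ c → length a + length c ≡ ℓ + (K + ℓ)
  suffix-length a c W≡ac = trans (sym (length-++ a)) (trans (cong length (sym W≡ac)) length-W)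

  -- A cover of W shorter than q would be a suffix of the last w and hence a cover of w.
  cover-of-W-not-shorter-than-q : {c : List B} → Covers c W → length q ≤ length c
  cover-of-W-not-shorter-than-q {c} c-covers-W with Covers⇒suffix c-covers-W 0<W
  ... | a , W≡ac = ≮⇒≥ λ c<q → no-shorter-cover (c-covers-w c<q) c<q
    where
    c-covers-w : length c < length q → Covers c w
    c-covers-w c<q with ++-split (w ++ V) w a c (trans (++-assoc w V w) W≡ac)
                           (≤-trans (≤-reflexive (length-++ w))
                                    (short-suffix-starts-after-V (suffix-length a c W≡ac) (<⇒≤ (<-trans c<q q<w))))
    ... | _ , _ , w≡mc = Covers-prefix c-covers-W w≡mc

  late-occurrence⇒q-in-V : {c : List B} {s : ℕ} → Covers c W → OccursAt c W s → ℓ ≤ s → s ≤ K →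
                           OccursAt q V (s ∸ ℓ)
  late-occurrence⇒q-in-V {c} {s} c-covers-W c-at-s ℓ≤s s≤K
    with q-prefix-of-W | Covers⇒prefix c-covers-W 0<W
  ... | b , W≡qb | b′ , W≡cb′
    with ++-split q b c b′ (trans (sym W≡qb) W≡cb′) (cover-of-W-not-shorter-than-q c-covers-W)
  ... | m , c≡qm , _ = OccursAt-++⁻ˡ (OccursAt-++⁻ʳ {A = w} q-at-s ℓ≤s) end≤K
    where
    q-at-s : OccursAt q W s
    q-at-s = OccursAt-prefix (subst (λ x → OccursAt x W s) c≡qm c-at-s)
    end≤K : s ∸ ℓ + length q ≤ K
    end≤K = begin
      s ∸ ℓ + length q    ≤⟨ +-monoʳ-≤ (s ∸ ℓ) (<⇒≤ q<w) ⟩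
      s ∸ ℓ + ℓ           ≡⟨ m∸n+n≡m ℓ≤s ⟩
      s                   ≤⟨ s≤K ⟩
      K                   ∎
      where open ≤-Reasoning

  early-occurrence⇒shorter-cover : {c : List B} → Covers c W → length c < length W → (s : ℕ) → OccursAt c W s →
                                   s < ℓ → K < s + length c → ∃ λ d → Covers d W × length d < length c
  early-occurrence⇒shorter-cover {c} c-covers-W c<W zero c-at-0 _ K<c with Covers⇒suffix c-covers-W 0<W
  ... | a , W≡ac = overlap⇒shorter-Covers c-covers-W c-at-0 c-at-a 0<a
                     (long-suffix-overlaps-prefix (suffix-length a c W≡ac) K<c)
    where
    c-at-a : OccursAt c W (length a)
    c-at-a = a , [] , trans W≡ac (cong (a ++_) (sym (++-identityʳ c))) , refl
    0<a : 0 < length a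
    0<a = ≢[]⇒0<length λ a≡[] → length<⇒≢ c<W (trans W≡ac (cong (_++ c) a≡[]))
  early-occurrence⇒shorter-cover c-covers-W _ (suc s) c-at-s s<ℓ K<s+c =
    overlap⇒shorter-Covers c-covers-W (Covers⇒OccursAt-start c-covers-W 0<W) c-at-s (s≤s z≤n)
                           (early-start-overlaps-prefix s<ℓ K<s+c)

  ProperCoverOfW : List B → Set
  ProperCoverOfW c = Covers c W × length c < length W

  -- Position K lies inside V, at least 3|w| past its start: an occurrence of c
  -- covering it starts either inside V or within |w| of the start of W.
  shorter-cover-or-q-in-V : {c : List B} → ProperCoverOfW c →
                            (∃ λ d → ProperCoverOfW d × length d < length c) ⊎ (∃ λ t → OccursAt q V t)
  shorter-cover-or-q-in-V (c-covers-W , c<W) with c-covers-W K K<W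
  ... | s , c-at-s , s≤K , K<s+c with ℓ ≤? s
  ... | yes ℓ≤s = inj₂ (s ∸ ℓ , late-occurrence⇒q-in-V c-covers-W c-at-s ℓ≤s s≤K)
  ... | no ℓ≰s with early-occurrence⇒shorter-cover c-covers-W c<W s c-at-s (≰⇒> ℓ≰s) K<s+c
  ...   | d , d-covers-W , d<c = inj₁ (d , (d-covers-W , <-trans d<c c<W) , d<c)

  q-occurs-in-V : {c : List B} → QPeriodic c W → ∃ λ t → OccursAt q V t
  q-occurs-in-V (_ , W≢c , c-covers-W) =
    descend-on-length ProperCoverOfW shorter-cover-or-q-in-V
      (c-covers-W , ++-proper-prefix-length (proj₂ (Covers⇒prefix c-covers-W 0<W)) W≢c)

  -- Since v V = V v, an occurrence of q in V recurs |v| positions later in V v.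
  q-shorter-than-vv : {t : ℕ} → OccursAt q V t → length q < 2 * p
  q-shorter-than-vv {t} q-at-t = ≰⇒> λ 2p≤q →
    let d , d-covers-w , d<q = overlap⇒shorter-Covers q-covers-w q-at-t-in-Vv q-at-t+p-in-Vv 0<v
                                 (≤-trans (≤-reflexive (cong (p +_) (sym (+-identityʳ p)))) 2p≤q)
    in no-shorter-cover d-covers-w d<q
    where
    q-at-t-in-Vv : OccursAt q (V ++ v) t
    q-at-t-in-Vv = OccursAt-++⁺ʳ v q-at-t
    q-at-t+p-in-Vv : OccursAt q (V ++ v) (t + p)
    q-at-t+p-in-Vv = subst₂ (OccursAt q) (pow-sucʳ v k) (+-comm p t) (OccursAt-++⁺ˡ v q-at-t)

  quasiperiod-in-cube : {c : List B} → QPeriodic c W → Factor q (cube v) × length q < 2 * p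
  quasiperiod-in-cube c-qp with q-occurs-in-V c-qp
  ... | _ , q-at-t = pow-occurrence⇒Factor-cube 0<v k q-at-t (m<n⇒m≤1+n q<2p) , q<2p
    where
    q<2p : length q < 2 * p
    q<2p = q-shorter-than-vv q-at-t

lemma4p1 : (m n : ℕ) (f : Fin m → List (Fin n)) → NonErasing f → StronglyQuasiperiodic f →
    (u : List (Fin m)) → u ≢ [] → (α : Fin m) → (q : List (Fin n)) → IsQuasiperiod q (extend f u) →
    Factor q (cube (f α)) × length q < 2 * length (f α)
lemma4p1 m n f f-ne f-sq u u≢[] α q q-quasiperiod =
  Pumping.quasiperiod-in-cube (extend f u) (f α) q q-quasiperiod
    (extend-nonempty f-ne u≢[]) 0<fα k (k≤length-pow 0<fα k)
    (subst (QPeriodic _) (extend-pumped f u α k u) (proj₂ (f-sq pumped (u≢[] ∘ ++-conicalˡ u _))))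
  where
  0<fα : 0 < length (f α)
  0<fα = ≢[]⇒0<length (f-ne α)
  k : ℕ
  k = 4 * length (extend f u)
  pumped : List (Fin m)
  pumped = u ++ replicate k α ++ u
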